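{- Let $\alpha$ be a composition and $n\ge1$. If $\beta$ is a composition with $\alpha<_c\beta$ such that $\beta/\!\!/\alpha$ is an nc border strip of size $n$, then there exists $w\in CRHW_n$ with $w(\alpha)=\beta$. That is, $B_{\alpha,n}\subseteq A_{\alpha,n}$, where $A_{\alpha,n}=\{w(\alpha):w\in CRHW_n\}\setminus\{0\}$ and $B_{\alpha,n}=\{\beta:\alpha<_c\beta,\ \beta/\!\!/\alpha\text{ an nc border strip of size }n\}$.
   Context: A composition is a finite sequence $\alpha=(\alpha_1,\ldots,\alpha_k)$ of positive integers; $l(\alpha)=k$, $|\alpha|=\sum\alpha_i$; its diagram is the set of boxes $(i,j)$ with $1\le i\le k$, $1\le j\le\alpha_i$ (rows top to bottom, columns left to right). Write $\alpha\lessdot_c\beta$ if $\beta=(1,\alpha_1,\ldots,\alpha_k)$, or $\beta$ is obtained from $\alpha$ by increasing a part $\alpha_m$ by one where $\alpha_i\ne\alpha_m$ for all $i<m$; $<_c$ is the transitive closure. If $\alpha<_c\beta$ and $d=l(\beta)-l(\alpha)$, the skew shape $\beta/\!\!/\alpha$ is the set of boxes of the diagram of $\beta$ not of the form $(i'+d,j)$ with $j\le\alpha_{i'}$; its size is $|\beta|-|\alpha|$; $\mathrm{supp}(\beta/\!\!/\alpha)$ is the set of columns containing its boxes. It is an interval shape if its support is a set of consecutive integers. An interval shape is an nc border strip if (1) whenever $(i,1),(i,2)\in\beta/\!\!/\alpha$, the box $(i,1)$ is the bottommost box of column 1 of $\beta/\!\!/\alpha$; (2) whenever $(i,j),(i,j+1)\in\beta/\!\!/\alpha$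 with $j\ge2$, the box $(i,j)$ is the topmost box of column $j$ of $\beta/\!\!/\alpha$. Box-adding operators: $\mathfrak{t}_1(\alpha)=(1,\alpha_1,\ldots,\alpha_k)$; for $i\ge2$, $\mathfrak{t}_i(\alpha)$ increases by one the leftmost part equal to $i-1$ if one exists, else is $0$; $\mathfrak{t}_i(0)=0$. A word $w=\mathfrak{t}_{i_1}\cdots\mathfrak{t}_{i_n}$ acts by $w(\alpha)=\mathfrak{t}_{i_1}(\cdots\mathfrak{t}_{i_n}(\alpha)\cdots)$. It is a reverse hookword if for some $0\le k\le n-1$, $i_1\le\cdots\le i_{k+1}>i_{k+2}>\cdots>i_n$; it is connected if $\{i_1,\ldots,i_n\}$ is a set of consecutive integers. $CRHW_n$ is the set of connected reverse hookwords of length $n$. -}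

module Defs where

open import Data.Nat using (ℕ; zero; suc; _+_; _∸_; _≤_; _<_; _>_; _≡ᵇ_)
open import Data.List using (List; []; _∷_; length; _++_; _∷ʳ_)
open import Data.Nat.ListAction using (sum)
open import Data.List.Relation.Unary.All using (All)
open import Data.List.Relation.Unary.Linked using (Linked)
open import Data.List.Membership.Propositional using (_∈_)
open import Data.Maybe using (Maybe; just; nothing)
import Data.Maybe as Maybe
open import Data.Bool using (if_then_else_)
open import Data.Product using (Σ; ∃; _×_; _,_)
open import Relation.Binary.PropositionalEquality using (_≡_; _≢_)
open import Relation.Binary.Construct.Closure.Transitive using (TransClosure)
open import Relation.Nullary using (¬_)

IsComposition : List ℕ → Set
IsComposition α = All (λ x → 1 ≤ x) α

-- 1-indexed part; 0 when out of range (index 0 or > length).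
part : List ℕ → ℕ → ℕ
part []       _             = 0
part (x ∷ xs) zero          = 0
part (x ∷ xs) (suc zero)    = x
part (x ∷ xs) (suc (suc i)) = part xs (suc i)

incAt : ℕ → List ℕ → List ℕ
incAt _             []       = []
incAt zero          xs       = xs
incAt (suc zero)    (x ∷ xs) = suc x ∷ xs
incAt (suc (suc m)) (x ∷ xs) = x ∷ incAt (suc m) xs

data _⋖c_ : List ℕ → List ℕ → Set where
  prepend : ∀ {α} → α ⋖c (1 ∷ α)
  increase : ∀ {α} (m : ℕ) → 1 ≤ m → m ≤ length α →
             (∀ i → 1 ≤ i → i < m → part α i ≢ part α m) →
             α ⋖c incAt m α

_<c_ : List ℕ → List ℕ → Set
_<c_ = TransClosure _⋖c_

-- Diagrams and skew shapes (boxes (i , j), rows i, columns j, 1-indexed).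

InDiagram : List ℕ → ℕ → ℕ → Set
InDiagram γ i j = 1 ≤ j × j ≤ part γ i   -- part γ 0 = 0, so i ≥ 1 automatically

InSkew : List ℕ → List ℕ → ℕ → ℕ → Set
InSkew α β i j =
  InDiagram β i j ×
  ¬ (Σ ℕ λ i' → i ≡ i' + (length β ∸ length α) × InDiagram α i' j)

skewSize : List ℕ → List ℕ → ℕ
skewSize α β = sum β ∸ sum α

InSupport : List ℕ → List ℕ → ℕ → Set
InSupport α β j = Σ ℕ λ i → InSkew α β i j

IsIntervalShape : List ℕ → List ℕ → Set
IsIntervalShape α β =
  ∀ a b c → InSupport α β a → InSupport α β b → a ≤ c → c ≤ b → InSupport α β c

IsNcBorderStrip : List ℕ → List ℕ → Set
IsNcBorderStrip α β =
  IsIntervalShape α β ×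
  (∀ i → InSkew α β i 1 → InSkew α β i 2 → ∀ i' → InSkew α β i' 1 → i' ≤ i) ×
  (∀ i j → 2 ≤ j → InSkew α β i j → InSkew α β i (suc j) →
     ∀ i' → InSkew α β i' j → i ≤ i')

-- Box-adding operators; `nothing` plays the role of 0.

incLeftmost : ℕ → List ℕ → Maybe (List ℕ)
incLeftmost v []       = nothing
incLeftmost v (x ∷ xs) =
  if x ≡ᵇ v then just (suc x ∷ xs) else Maybe.map (x ∷_) (incLeftmost v xs)

t : ℕ → Maybe (List ℕ) → Maybe (List ℕ)
t _             nothing  = nothing
t zero          (just α) = nothing   -- never used: letters are ≥ 1
t (suc zero)    (just α) = just (1 ∷ α)
t (suc (suc i)) (just α) = incLeftmost (suc i) α

act : List ℕ → List ℕ → Maybe (List ℕ)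
act []      α = just α
act (i ∷ w) α = t i (act w α)

IsReverseHookword : List ℕ → Set
IsReverseHookword w =
  Σ (List ℕ) λ u → Σ ℕ λ x → Σ (List ℕ) λ v →
    w ≡ u ++ (x ∷ v) × Linked _≤_ (u ∷ʳ x) × Linked _>_ (x ∷ v)

IsConnected : List ℕ → Set
IsConnected w = ∀ a b c → a ∈ w → b ∈ w → a ≤ c → c ≤ b → c ∈ w

CRHW : ℕ → List ℕ → Set
CRHW n w = length w ≡ n × All (λ i → 1 ≤ i) w × IsReverseHookword w × IsConnected w

-- Let d = l(β) − l(α), so that row r of β carries row r − d of α. Along the cover
-- relations of α <c β one checks that α_{r−d} ≤ β_r, and that β_{r′} ≤ β_r whenever
-- r < r′ and α_{r′−d} ≤ α_{r−d}. The strip β//α is then filled one box at a time by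
-- single operators 𝔱_s, each new letter being put in front of the word: while the strip
-- contains a horizontal domino, fill the left box of the leftmost one; once it contains
-- none, every row holds one box, and fill the topmost box of the rightmost column. The nc
-- conditions and the inequality above make the chosen box exactly the one 𝔱_s fills (the
-- new top row for s = 1, otherwise the topmost row whose part is s − 1). Domino letters
-- increase from one step to the next and the later letters weakly decrease, so the word
-- is a reverse hookword; its letters are the columns of the strip, an interval.

module Submission where

open import Defs
open import Data.Bool using (true; false)
open import Data.Empty using (⊥-elim)
open import Data.List using (List; []; _∷_; length; _++_; _∷ʳ_; last)
open import Data.List.Membership.Propositional using (_∈_)
open import Data.List.Membership.Propositional.Properties using (∈-++⁺ˡ; ∈-++⁻; ∈-insert)
open import Data.List.Properties using (++-assoc; length-++)
open import Data.List.Relation.Unary.All using (All; []; _∷_; tabulate)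
open import Data.List.Relation.Unary.Any using (here; there)
open import Data.List.Relation.Unary.Linked using (Linked; []; [-]; _∷_)
open import Data.Maybe using (just)
open import Data.Maybe.Properties using (just-injective)
open import Data.Nat using (ℕ; zero; suc; _+_; _∸_; _≤_; _≰_; _<_; _≡ᵇ_; z≤n; s≤s)
open import Data.Nat.Induction using (<-rec)
open import Data.Nat.ListAction using (sum)
open import Data.Nat.Properties
open import Data.Product using (Σ; ∃; _×_; _,_; proj₁; proj₂)
open import Data.Sum using (_⊎_; inj₁; inj₂)
open import Relation.Binary.Construct.Closure.Transitive using ([_]; _∷_)
open import Relation.Binary.Definitions using (tri<; tri≈; tri>)
open import Relation.Binary.PropositionalEquality
open import Relation.Nullary using (¬_; Dec; yes; no)
open import Relation.Nullary.Decidable using (map′; _×-dec_)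

part-zero : ∀ xs → part xs 0 ≡ 0
part-zero []      = refl
part-zero (_ ∷ _) = refl

part-∷ : ∀ x xs {i} → 1 ≤ i → part (x ∷ xs) (suc i) ≡ part xs i
part-∷ x xs {suc i} _ = refl

composition-part≥1 : ∀ {xs} → IsComposition xs → ∀ {i} → 1 ≤ i → i ≤ length xs → 1 ≤ part xs i
composition-part≥1 (p ∷ _)  {suc zero}    _ _       = p
composition-part≥1 (_ ∷ ps) {suc (suc i)} _ (s≤s h) = composition-part≥1 ps (s≤s z≤n) h

part≥1⇒index∈range : ∀ xs {i} → 1 ≤ part xs i → 1 ≤ i × i ≤ length xs
part≥1⇒index∈range (_ ∷ _)  {suc zero}    _ = s≤s z≤n , s≤s z≤n
part≥1⇒index∈range (_ ∷ xs) {suc (suc i)} h = s≤s z≤n , s≤s (proj₂ (part≥1⇒index∈range xs h))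

part≤sum : ∀ xs i → part xs i ≤ sum xs
part≤sum []       _             = z≤n
part≤sum (_ ∷ _)  zero          = z≤n
part≤sum (x ∷ xs) (suc zero)    = m≤m+n x (sum xs)
part≤sum (x ∷ xs) (suc (suc i)) = ≤-trans (part≤sum xs (suc i)) (m≤n+m (sum xs) x)

≡-by-parts : ∀ (xs ys : List ℕ) → length xs ≡ length ys →
             (∀ i → 1 ≤ i → part xs i ≡ part ys i) → xs ≡ ys
≡-by-parts []       []       _  _  = refl
≡-by-parts (x ∷ xs) (y ∷ ys) eq ps = cong₂ _∷_ (ps 1 (s≤s z≤n))
  (≡-by-parts xs ys (suc-injective eq) λ { (suc i) _ → ps (suc (suc i)) (s≤s z≤n) })

length-incAt : ∀ i xs → length (incAt i xs) ≡ length xs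
length-incAt _             []       = refl
length-incAt zero          (_ ∷ _)  = refl
length-incAt (suc zero)    (_ ∷ _)  = refl
length-incAt (suc (suc i)) (_ ∷ xs) = cong suc (length-incAt (suc i) xs)

part-incAt-≡ : ∀ {i} xs → 1 ≤ i → i ≤ length xs → part (incAt i xs) i ≡ suc (part xs i)
part-incAt-≡ {suc zero}    (_ ∷ _)  _ _       = refl
part-incAt-≡ {suc (suc i)} (_ ∷ xs) _ (s≤s h) = part-incAt-≡ xs (s≤s z≤n) h

part-incAt-≢ : ∀ i xs {j} → j ≢ i → part (incAt i xs) j ≡ part xs j
part-incAt-≢ _             []       _  = refl
part-incAt-≢ zero          (_ ∷ _)  _  = refl
part-incAt-≢ (suc zero)    (_ ∷ _)  {zero}        _  = refl
part-incAt-≢ (suc zero)    (_ ∷ _)  {suc zero}    ne = ⊥-elim (ne refl)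
part-incAt-≢ (suc zero)    (_ ∷ _)  {suc (suc _)} _  = refl
part-incAt-≢ (suc (suc _)) (_ ∷ _)  {zero}        _  = refl
part-incAt-≢ (suc (suc _)) (_ ∷ _)  {suc zero}    _  = refl
part-incAt-≢ (suc (suc i)) (_ ∷ xs) {suc (suc j)} ne = part-incAt-≢ (suc i) xs (λ e → ne (cong suc e))

part≤part-incAt : ∀ i xs j → part xs j ≤ part (incAt i xs) j
part≤part-incAt _             []       _             = ≤-refl
part≤part-incAt zero          (_ ∷ _)  _             = ≤-refl
part≤part-incAt (suc zero)    (_ ∷ _)  zero          = ≤-refl
part≤part-incAt (suc zero)    (x ∷ _)  (suc zero)    = n≤1+n x
part≤part-incAt (suc zero)    (_ ∷ _)  (suc (suc _)) = ≤-refl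
part≤part-incAt (suc (suc _)) (_ ∷ _)  zero          = ≤-refl
part≤part-incAt (suc (suc _)) (_ ∷ _)  (suc zero)    = ≤-refl
part≤part-incAt (suc (suc i)) (_ ∷ xs) (suc (suc j)) = part≤part-incAt (suc i) xs (suc j)

sum-incAt : ∀ {i} xs → 1 ≤ i → i ≤ length xs → sum (incAt i xs) ≡ suc (sum xs)
sum-incAt {suc zero}    (_ ∷ _)  _ _       = refl
sum-incAt {suc (suc i)} (x ∷ xs) _ (s≤s h) = trans (cong (x +_) (sum-incAt xs (s≤s z≤n) h)) (+-suc x (sum xs))

incAt-composition : ∀ i {xs} → IsComposition xs → IsComposition (incAt i xs)
incAt-composition _             []       = []
incAt-composition zero          (p ∷ ps) = p ∷ ps
incAt-composition (suc zero)    (_ ∷ ps) = s≤s z≤n ∷ ps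
incAt-composition (suc (suc i)) (p ∷ ps) = p ∷ incAt-composition (suc i) ps

incLeftmost-firstMatch : ∀ v xs {i} → 1 ≤ i → i ≤ length xs → part xs i ≡ v →
  (∀ {j} → 1 ≤ j → j < i → part xs j ≢ v) → incLeftmost v xs ≡ just (incAt i xs)
-- The missing `false` case is absurd: the second abstracted term then has type T false.
incLeftmost-firstMatch v (x ∷ xs) {suc zero} _ _ refl _ with x ≡ᵇ x | ≡⇒≡ᵇ x x refl
... | true  | _ = refl
incLeftmost-firstMatch v (x ∷ xs) {suc (suc i)} _ (s≤s h) xs≡v earlier with x ≡ᵇ v | ≡ᵇ⇒≡ x v
... | true  | x≡v = ⊥-elim (earlier (s≤s z≤n) (s≤s (s≤s z≤n)) (x≡v _))
... | false | _   rewrite incLeftmost-firstMatch v xs (s≤s z≤n) h xs≡v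
                            (λ { {suc j} _ (s≤s j<i) → earlier (s≤s z≤n) (s≤s (s≤s j<i)) }) = refl

module BoundedSearch {Q : ℕ → Set} (Q? : ∀ n → Dec (Q n)) where

  least : ∀ n → Q n → ∃ λ m → Q m × (∀ {j} → j < m → ¬ Q j)
  least = <-rec _ go
    where
      go : ∀ n → (∀ {m} → m < n → Q m → ∃ λ m → Q m × (∀ {j} → j < m → ¬ Q j)) →
           Q n → ∃ λ m → Q m × (∀ {j} → j < m → ¬ Q j)
      go n smaller qn with anyUpTo? Q? n
      ... | yes (m , m<n , qm) = smaller m<n qm
      ... | no  none           = n , qn , λ j<n qj → none (_ , j<n , qj)

  greatest : ∀ N → (∀ {j} → Q j → j < N) → ∀ n → Q n → ∃ λ m → Q m × (∀ {j} → Q j → j ≤ m)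
  greatest zero    bound n qn = ⊥-elim (n≮0 (bound qn))
  greatest (suc N) bound n qn with Q? N
  ... | yes qN = N , qN , λ qj → ≤-pred (bound qj)
  ... | no ¬qN = greatest N (λ {j} qj → ≤∧≢⇒< (≤-pred (bound qj)) λ { refl → ¬qN qj }) n qn

  ∃? : ∀ N → (∀ {j} → Q j → j < N) → Dec (∃ Q)
  ∃? N bound = map′ (λ (j , _ , qj) → j , qj) (λ (j , qj) → j , bound qj , qj) (anyUpTo? Q? N)

act-∷ʳ : ∀ w s {α α′} → t s (just α) ≡ just α′ → act (w ∷ʳ s) α ≡ act w α′
act-∷ʳ []      _ eq = eq
act-∷ʳ (i ∷ w) s eq = cong (t i) (act-∷ʳ w s eq)

last-∷ʳ : ∀ (w : List ℕ) s → last (w ∷ʳ s) ≡ just s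
last-∷ʳ []          _ = refl
last-∷ʳ (_ ∷ [])    _ = refl
last-∷ʳ (_ ∷ y ∷ w) s = last-∷ʳ (y ∷ w) s

last-++-∷ : ∀ (u : List ℕ) x v → last (u ++ x ∷ v) ≡ last (x ∷ v)
last-++-∷ []          _ _ = refl
last-++-∷ (_ ∷ [])    x v = refl
last-++-∷ (_ ∷ y ∷ u) x v = last-++-∷ (y ∷ u) x v

last∈ : ∀ {w : List ℕ} {l} → last w ≡ just l → l ∈ w
last∈ {_ ∷ []}    refl = here refl
last∈ {_ ∷ _ ∷ _} eq   = there (last∈ eq)

Linked≤⇒≤last : ∀ {w : List ℕ} {c l} → Linked _≤_ w → c ∈ w → last w ≡ just l → c ≤ l
Linked≤⇒≤last [-]           (here refl) refl = ≤-refl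
Linked≤⇒≤last (x≤y ∷ links) (here refl) eq   = ≤-trans x≤y (Linked≤⇒≤last links (here refl) eq)
Linked≤⇒≤last (_   ∷ links) (there c∈) eq    = Linked≤⇒≤last links c∈ eq

Linked-∷ʳ : ∀ {R : ℕ → ℕ → Set} {w s} → Linked R w → (∀ {l} → last w ≡ just l → R l s) →
            Linked R (w ∷ʳ s)
Linked-∷ʳ []          _    = [-]
Linked-∷ʳ [-]         ends = ends refl ∷ [-]
Linked-∷ʳ (r ∷ links) ends = r ∷ Linked-∷ʳ links ends

increasing⇒reverseHookword : ∀ {w s} → Linked _≤_ (w ∷ʳ s) → IsReverseHookword (w ∷ʳ s)
increasing⇒reverseHookword {w} {s} inc = w , s , [] , refl , inc , [-]

reverseHookword-∷ʳ : ∀ {w s} → IsReverseHookword w → (∀ {l} → last w ≡ just l → s < l) →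
  IsReverseHookword (w ∷ʳ s)
reverseHookword-∷ʳ {s = s} (u , x , v , refl , inc , dec) ends =
  u , x , v ∷ʳ s , ++-assoc u (x ∷ v) (s ∷ []) , inc ,
  Linked-∷ʳ dec (λ eq → ends (trans (last-++-∷ u x v) eq))

m∸o≡n∸o∧o<n⇒m≡n : ∀ {m n o} → o < n → m ∸ o ≡ n ∸ o → m ≡ n
m∸o≡n∸o∧o<n⇒m≡n {m} {n} {o} o<n eq = ∸-cancelʳ-≡ (<⇒≤ o<m) (<⇒≤ o<n) eq
  where
    o<m : o < m
    o<m = m∸n≢0⇒n<m (λ m∸o≡0 → <-irrefl (trans (sym m∸o≡0) eq) (m<n⇒0<n∸m o<n))

-- The part of α carried by row r of β when β has d more rows; it is 0 on the d top rows
-- since r ∸ d truncates to 0 and part xs 0 = 0.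
shifted : ℕ → List ℕ → ℕ → ℕ
shifted d α r = part α (r ∸ d)

shifted-top : ∀ {d} α {r} → r ≤ d → shifted d α r ≡ 0
shifted-top α r≤d = trans (cong (part α) (m≤n⇒m∸n≡0 r≤d)) (part-zero α)

shifted-prepend : ∀ d α {r} → r ≢ suc d → shifted d (1 ∷ α) r ≡ shifted (suc d) α r
shifted-prepend d α {zero}   _  = trans (cong (part (1 ∷ α)) (0∸n≡0 d)) (sym (part-zero α))
shifted-prepend d α {suc r} r≢ with <-cmp r d
... | tri< r<d _ _  = trans (shifted-top (1 ∷ α) r<d) (sym (shifted-top α (<⇒≤ r<d)))
... | tri≈ _ refl _ = ⊥-elim (r≢ refl)
... | tri> _ _ d<r  = trans (cong (part (1 ∷ α)) (+-∸-assoc 1 (<⇒≤ d<r))) (part-∷ 1 α (m<n⇒0<n∸m d<r))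

record Fits (d : ℕ) (α β : List ℕ) : Set where
  field
    rows    : d + length α ≡ length β
    inside  : ∀ {r} → d < r → shifted d α r ≤ part β r
    ordered : ∀ {r r′} → d < r → r < r′ → shifted d α r′ ≤ shifted d α r → part β r′ ≤ part β r

fits-length : ∀ {d α β} → Fits d α β → length β ∸ d ≡ length α
fits-length {d} {α} fits = trans (cong (_∸ d) (sym (Fits.rows fits))) (m+n∸m≡n d (length α))

fits-extraRows : ∀ {d α β} → Fits d α β → length β ∸ length α ≡ d
fits-extraRows {d} {α} fits = trans (cong (_∸ length α) (sym (Fits.rows fits))) (m+n∸n≡m d (length α))

fits-refl : ∀ α → Fits 0 α α
fits-refl α = record { rows = refl ; inside = λ _ → ≤-refl ; ordered = λ _ _ le → le }

fits-⋖c : ∀ {d α γ β} → Fits d α γ → γ ⋖c β → ∃ λ d′ → Fits d′ α β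
fits-⋖c {d} fits prepend = suc d , record
  { rows    = cong suc rows
  ; inside  = λ { {suc (suc _)} (s≤s d<r) → inside d<r }
  ; ordered = λ { {suc (suc _)} {suc (suc _)} (s≤s d<r) (s≤s r<r′) → ordered d<r r<r′ }
  }
  where open Fits fits
fits-⋖c {d} {α} {γ} fits (increase m 1≤m m≤len earlier) = d , record
  { rows    = trans rows (sym (length-incAt m γ))
  ; inside  = λ {r} d<r → ≤-trans (inside d<r) (part≤part-incAt m γ r)
  ; ordered = ordered′
  }
  where
    open Fits fits
    ordered′ : ∀ {r r′} → d < r → r < r′ → shifted d α r′ ≤ shifted d α r →
               part (incAt m γ) r′ ≤ part (incAt m γ) r
    ordered′ {r} {r′} d<r r<r′ le with r′ ≟ m
    ... | no r′≢m = begin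
      part (incAt m γ) r′ ≡⟨ part-incAt-≢ m γ r′≢m ⟩
      part γ r′           ≤⟨ ordered d<r r<r′ le ⟩
      part γ r            ≤⟨ part≤part-incAt m γ r ⟩
      part (incAt m γ) r  ∎
      where open ≤-Reasoning
    ... | yes refl = begin
      part (incAt r′ γ) r′ ≡⟨ part-incAt-≡ γ 1≤m m≤len ⟩
      suc (part γ r′)      ≤⟨ ≤∧≢⇒< (ordered d<r r<r′ le) (λ eq → earlier r 1≤r r<r′ (sym eq)) ⟩
      part γ r             ≤⟨ part≤part-incAt r′ γ r ⟩
      part (incAt r′ γ) r  ∎
      where
        open ≤-Reasoning
        1≤r : 1 ≤ r
        1≤r = ≤-trans (s≤s z≤n) d<r

sum-⋖c : ∀ {γ β} → γ ⋖c β → sum β ≡ suc (sum γ)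
sum-⋖c prepend                          = refl
sum-⋖c {γ} (increase m 1≤m m≤len _) = sum-incAt γ 1≤m m≤len

fits-<c : ∀ {d α γ β} → Fits d α γ → γ <c β → ∃ λ d′ → Fits d′ α β
fits-<c fits [ γ⋖β ]      = fits-⋖c fits γ⋖β
fits-<c fits (γ⋖δ ∷ δ<β) = fits-<c (proj₂ (fits-⋖c fits γ⋖δ)) δ<β

<c⇒fits : ∀ {α β} → α <c β → Fits (length β ∸ length α) α β
<c⇒fits {α} {β} α<β = let (d , fits) = fits-<c (fits-refl α) α<β in
  subst (λ d → Fits d α β) (sym (fits-extraRows fits)) fits

sum-<c : ∀ {γ β} → γ <c β → sum γ < sum β
sum-<c [ γ⋖β ]      = ≤-reflexive (sym (sum-⋖c γ⋖β))
sum-<c (γ⋖δ ∷ δ<β) = <-trans (≤-reflexive (sym (sum-⋖c γ⋖δ))) (sum-<c δ<β)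

sum≤-shifted : ∀ d α β → d + length α ≡ length β → (∀ {r} → d < r → shifted d α r ≤ part β r) →
               sum α ≤ sum β
sum≤-shifted (suc d) α (_ ∷ β) rows inside = ≤-trans
  (sum≤-shifted d α β (suc-injective rows) λ { {suc _} (s≤s d<r) → inside (s≤s (s≤s d<r)) })
  (m≤n+m (sum β) _)
sum≤-shifted zero [] _ _ _ = z≤n
sum≤-shifted zero (_ ∷ α) (_ ∷ β) rows inside = +-mono-≤
  (inside {1} (s≤s z≤n))
  (sum≤-shifted zero α β (suc-injective rows) λ { {suc r} _ → inside {suc (suc r)} (s≤s z≤n) })

fits⇒sum≤ : ∀ {d α β} → Fits d α β → sum α ≤ sum β
fits⇒sum≤ {d} {α} {β} fits = sum≤-shifted d α β (Fits.rows fits) (Fits.inside fits)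

module Peeling (β : List ℕ) (β-composition : IsComposition β) where

  BoxOver : (ℕ → ℕ) → ℕ → ℕ → Set
  BoxOver floor r c = floor r < c × c ≤ part β r

  Box : ℕ → List ℕ → ℕ → ℕ → Set
  Box d α = BoxOver (shifted d α)

  -- Raising the floor of row r₀ from s − 1 to s removes exactly the box (r₀ , s).
  module Bump (lo lo′ : ℕ → ℕ) (r₀ s : ℕ) (below : suc (lo r₀) ≡ s) (raised : lo′ r₀ ≡ s)
              (kept : ∀ {r} → r ≢ r₀ → lo′ r ≡ lo r) where

    shrinks : ∀ {r c} → BoxOver lo′ r c → BoxOver lo r c
    shrinks {r} (lo′<c , c≤β) with r ≟ r₀
    ... | yes refl = <-trans (≤-reflexive below) (subst (_< _) raised lo′<c) , c≤β
    ... | no  r≢r₀ = subst (_< _) (kept r≢r₀) lo′<c , c≤β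

    split : ∀ {r c} → BoxOver lo r c → (r ≡ r₀ × c ≡ s) ⊎ BoxOver lo′ r c
    split {r} (lo<c , c≤β) with r ≟ r₀
    ... | no  r≢r₀ = inj₂ (subst (_< _) (sym (kept r≢r₀)) lo<c , c≤β)
    ... | yes refl with m≤n⇒m<n∨m≡n lo<c
    ...   | inj₁ s<c  = inj₂ (subst (_< _) (trans below (sym raised)) s<c , c≤β)
    ...   | inj₂ s≡c  = inj₁ (refl , trans (sym s≡c) below)

    removed : ¬ BoxOver lo′ r₀ s
    removed (lo′<s , _) = <-irrefl raised lo′<s

    inside′ : ∀ {D} → (∀ {r} → D < r → r ≢ r₀ → lo r ≤ part β r) → s ≤ part β r₀ →
              ∀ {r} → D < r → lo′ r ≤ part β r
    inside′ old s≤β {r} D<r with r ≟ r₀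
    ... | yes refl = ≤-trans (≤-reflexive raised) s≤β
    ... | no  r≢r₀ = ≤-trans (≤-reflexive (kept r≢r₀)) (old D<r r≢r₀)

    ordered′ : ∀ {D} → (∀ {r r′} → D < r → r ≢ r₀ → r < r′ → lo r′ ≤ lo r → part β r′ ≤ part β r) →
               (∀ {r′} → r₀ < r′ → lo r′ ≤ s → part β r′ ≤ part β r₀) →
               ∀ {r r′} → D < r → r < r′ → lo′ r′ ≤ lo′ r → part β r′ ≤ part β r
    ordered′ old later {r} {r′} D<r r<r′ le with r ≟ r₀ | r′ ≟ r₀
    ... | yes refl | yes refl = ⊥-elim (<-irrefl refl r<r′)
    ... | yes refl | no r′≢r₀ = later r<r′ (subst₂ _≤_ (kept r′≢r₀) raised le)
    ... | no r≢r₀  | yes refl =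
      old D<r r≢r₀ r<r′ (<⇒≤ (subst₂ _≤_ (trans raised (sym below)) (kept r≢r₀) le))
    ... | no r≢r₀  | no r′≢r₀ = old D<r r≢r₀ r<r′ (subst₂ _≤_ (kept r′≢r₀) (kept r≢r₀) le)

  record Peel (d : ℕ) (α : List ℕ) (r₀ s : ℕ) : Set where
    field
      d′          : ℕ
      α′          : List ℕ
      composition : IsComposition α′
      fits        : Fits d′ α′ β
      acts        : t s (just α) ≡ just α′
      grows       : sum α′ ≡ suc (sum α)
      shrinks     : ∀ {r c} → Box d′ α′ r c → Box d α r c
      split       : ∀ {r c} → Box d α r c → (r ≡ r₀ × c ≡ s) ⊎ Box d′ α′ r c
      removed     : ¬ Box d′ α′ r₀ s

  peel-incLeftmost : ∀ {d α r₀ v} → IsComposition α → Fits d α β → d < r₀ →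
    shifted d α r₀ ≡ suc v → suc (suc v) ≤ part β r₀ →
    (∀ {r} → d < r → r < r₀ → shifted d α r ≢ suc v) →
    (∀ {r} → r₀ < r → shifted d α r ≡ suc (suc v) → part β r ≤ part β r₀) →
    Peel d α r₀ (suc (suc v))
  peel-incLeftmost {d} {α} {r₀} {v} α-comp fits d<r₀ floor≡ s≤β earlier later = record
    { d′          = d
    ; α′          = incAt i α
    ; composition = incAt-composition i α-comp
    ; fits        = record
      { rows    = trans (cong (d +_) (length-incAt i α)) rows
      ; inside  = B.inside′ (λ d<r _ → inside d<r) s≤β
      ; ordered = B.ordered′ (λ d<r _ → ordered d<r) later′
      }
    ; acts        = incLeftmost-firstMatch (suc v) α 1≤i i≤len floor≡ earlier′
    ; grows       = sum-incAt α 1≤i i≤len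
    ; shrinks     = B.shrinks
    ; split       = B.split
    ; removed     = B.removed
    }
    where
      open Fits fits
      i : ℕ
      i = r₀ ∸ d
      1≤i : 1 ≤ i
      1≤i = m<n⇒0<n∸m d<r₀
      i≤len : i ≤ length α
      i≤len = ≤-trans (∸-monoˡ-≤ d (proj₂ (part≥1⇒index∈range β (≤-trans (s≤s z≤n) s≤β))))
                      (≤-reflexive (fits-length fits))
      kept : ∀ {r} → r ≢ r₀ → shifted d (incAt i α) r ≡ shifted d α r
      kept r≢r₀ = part-incAt-≢ i α (λ eq → r≢r₀ (m∸o≡n∸o∧o<n⇒m≡n d<r₀ eq))
      module B = Bump (shifted d α) (shifted d (incAt i α)) r₀ (suc (suc v))
                      (cong suc floor≡) (trans (part-incAt-≡ α 1≤i i≤len) (cong suc floor≡)) kept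
      earlier′ : ∀ {j} → 1 ≤ j → j < i → part α j ≢ suc v
      earlier′ {j} 1≤j j<i = subst (_≢ suc v) (cong (part α) (m+n∸n≡m j d)) (earlier d<j+d j+d<r₀)
        where
          d<j+d : d < j + d
          d<j+d = +-monoˡ-≤ d 1≤j
          j+d<r₀ : j + d < r₀
          j+d<r₀ = subst (j + d <_) (m∸n+n≡m (<⇒≤ d<r₀)) (+-monoˡ-< d j<i)
      later′ : ∀ {r} → r₀ < r → shifted d α r ≤ suc (suc v) → part β r ≤ part β r₀
      later′ r₀<r le with m≤n⇒m<n∨m≡n le
      ... | inj₁ lt = ordered d<r₀ r₀<r (≤-trans (≤-pred lt) (≤-reflexive (sym floor≡)))
      ... | inj₂ eq = later r₀<r eq

  peel-prepend : ∀ {d α} → 1 ≤ d → IsComposition α → Fits d α β → 1 ≤ part β d →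
    (∀ {r} → d < r → shifted d α r ≤ 1 → part β r ≤ part β d) →
    Peel d α d 1
  peel-prepend {suc d} {α} _ α-comp fits 1≤β later = record
    { d′          = d
    ; α′          = 1 ∷ α
    ; composition = s≤s z≤n ∷ α-comp
    ; fits        = record
      { rows    = trans (+-suc d (length α)) rows
      ; inside  = B.inside′ (λ d<r r≢ → inside (beyond d<r r≢)) 1≤β
      ; ordered = B.ordered′ (λ d<r r≢ → ordered (beyond d<r r≢)) later
      }
    ; acts        = refl
    ; grows       = refl
    ; shrinks     = B.shrinks
    ; split       = B.split
    ; removed     = B.removed
    }
    where
      open Fits fits
      beyond : ∀ {r} → d < r → r ≢ suc d → suc d < r
      beyond d<r r≢ = ≤∧≢⇒< d<r (λ eq → r≢ (sym eq))
      module B = Bump (shifted (suc d) α) (shifted d (1 ∷ α)) (suc d) 1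
                      (cong suc (trans (cong (part α) (n∸n≡0 d)) (part-zero α)))
                      (cong (part (1 ∷ α)) (trans (+-∸-assoc 1 (≤-refl {d})) (cong suc (n∸n≡0 d))))
                      (shifted-prepend d α)

  Column : ℕ → List ℕ → ℕ → Set
  Column d α c = ∃ λ r → Box d α r c

  Domino : ℕ → List ℕ → ℕ → Set
  Domino d α c = ∃ λ r → Box d α r c × Box d α r (suc c)

  record NcBorder (d : ℕ) (α : List ℕ) : Set where
    field
      bottom : ∀ {r r′} → Box d α r 1 → Box d α r 2 → Box d α r′ 1 → r′ ≤ r
      top    : ∀ {r r′ j} → 2 ≤ j → Box d α r j → Box d α r (suc j) → Box d α r′ j → r ≤ r′

  ncBorder-shrink : ∀ {d α d′ α′} → (∀ {r c} → Box d′ α′ r c → Box d α r c) →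
                    NcBorder d α → NcBorder d′ α′
  ncBorder-shrink sub nc = record
    { bottom = λ a b c → bottom (sub a) (sub b) (sub c)
    ; top    = λ 2≤j a b c → top 2≤j (sub a) (sub b) (sub c)
    }
    where open NcBorder nc

  domino-row-unique : ∀ {d α} → NcBorder d α → ∀ {r r′ s} →
    Box d α r s → Box d α r (suc s) → Box d α r′ s → Box d α r′ (suc s) → r ≡ r′
  domino-row-unique nc {s = zero}        (() , _) _ _ _
  domino-row-unique nc {s = suc zero}    a b a′ b′ = ≤-antisym (bottom a′ b′ a) (bottom a b a′)
    where open NcBorder nc
  domino-row-unique nc {s = suc (suc _)} a b a′ b′ =
    ≤-antisym (top (s≤s (s≤s z≤n)) a b a′) (top (s≤s (s≤s z≤n)) a′ b′ a)
    where open NcBorder nc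

  -- The letter of the first box filled is the last letter of the word; `ending` keeps
  -- what the letter of the next box needs to extend the reverse hook.
  record Spelling (d : ℕ) (α : List ℕ) (k : ℕ) : Set where
    field
      word          : List ℕ
      hook          : word ≡ [] ⊎ IsReverseHookword word
      spells        : act word α ≡ just β
      length≡       : length word ≡ k
      letter⇒column : ∀ {c} → c ∈ word → Column d α c
      column⇒letter : ∀ {r c} → Box d α r c → c ∈ word
      ending        : Linked _≤_ word ⊎ ∃ λ c → Domino d α c × last word ≡ just c

  nonempty⇒reverseHookword : ∀ {w : List ℕ} {c} → c ∈ w → w ≡ [] ⊎ IsReverseHookword w →
                             IsReverseHookword w
  nonempty⇒reverseHookword () (inj₁ refl)
  nonempty⇒reverseHookword _  (inj₂ hook) = hook

  record Move (d : ℕ) (α : List ℕ) : Set where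
    field
      {r₀ s} : ℕ
      peel   : Peel d α r₀ s
      extend : ∀ {k} → Spelling (Peel.d′ peel) (Peel.α′ peel) k → Spelling d α (suc k)

  module Extend {d α r₀ s} (peel : Peel d α r₀ s) (box : Box d α r₀ s) where
    open Peel peel

    extend-∷ʳ : ∀ {k} (sp : Spelling d′ α′ k) → let w = Spelling.word sp in
      IsReverseHookword (w ∷ʳ s) →
      Linked _≤_ (w ∷ʳ s) ⊎ (∃ λ c → Domino d α c × last (w ∷ʳ s) ≡ just c) →
      Spelling d α (suc k)
    extend-∷ʳ sp hook′ ending′ = record
      { word          = word ∷ʳ s
      ; hook          = inj₂ hook′
      ; spells        = trans (act-∷ʳ word s acts) spells
      ; length≡       = trans (length-++ word) (trans (+-comm (length word) 1) (cong suc length≡))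
      ; letter⇒column = letter⇒column′
      ; column⇒letter = column⇒letter′
      ; ending        = ending′
      }
      where
        open Spelling sp
        letter⇒column′ : ∀ {c} → c ∈ word ∷ʳ s → Column d α c
        letter⇒column′ c∈ with ∈-++⁻ word c∈
        ... | inj₁ c∈w          = let (r , b) = letter⇒column c∈w in r , shrinks b
        ... | inj₂ (here refl) = r₀ , box
        column⇒letter′ : ∀ {r c} → Box d α r c → c ∈ word ∷ʳ s
        column⇒letter′ b with split b
        ... | inj₁ (_ , refl) = ∈-insert word
        ... | inj₂ b′         = ∈-++⁺ˡ (column⇒letter b′)

    extend-domino : Box d α r₀ (suc s) → (∀ {c} → Domino d′ α′ c → s < c) → Move d α
    extend-domino box⁺ beyond = record
      { peel   = peel
      ; extend = λ sp → extend-∷ʳ sp (hook′ sp) (inj₂ (s , (r₀ , box , box⁺) , last-∷ʳ (Spelling.word sp) s))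
      }
      where
        box⁺′ : Box d′ α′ r₀ (suc s)
        box⁺′ with split box⁺
        ... | inj₁ (_ , s+1≡s) = ⊥-elim (<-irrefl (sym s+1≡s) ≤-refl)
        ... | inj₂ b           = b
        hook′ : ∀ {k} (sp : Spelling d′ α′ k) → IsReverseHookword (Spelling.word sp ∷ʳ s)
        hook′ sp = reverseHookword-∷ʳ (nonempty⇒reverseHookword s+1∈ hook) ends
          where
            open Spelling sp
            s+1∈ : suc s ∈ word
            s+1∈ = column⇒letter box⁺′
            ends : ∀ {l} → last word ≡ just l → s < l
            ends with ending
            ... | inj₁ increasing         = Linked≤⇒≤last increasing s+1∈
            ... | inj₂ (c , dom , last≡) = λ eq → subst (s <_) (just-injective (trans (sym last≡) eq)) (beyond dom)

    extend-vertical : (∀ {c} → ¬ Domino d α c) → (∀ {r c} → Box d α r c → c ≤ s) → Move d α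
    extend-vertical flat highest = record
      { peel   = peel
      ; extend = λ sp → extend-∷ʳ sp (increasing⇒reverseHookword (increasing sp)) (inj₁ (increasing sp))
      }
      where
        increasing : ∀ {k} (sp : Spelling d′ α′ k) → Linked _≤_ (Spelling.word sp ∷ʳ s)
        increasing sp with Spelling.ending sp
        ... | inj₁ inc = Linked-∷ʳ inc λ eq → highest (shrinks (proj₂ (Spelling.letter⇒column sp (last∈ eq))))
        ... | inj₂ (_ , (r , b , b′) , _) = ⊥-elim (flat (r , shrinks b , shrinks b′))

  top-box : ∀ {d α} → Fits d α β → 1 ≤ d → Box d α d 1
  top-box {d} {α} fits 1≤d = s≤s (≤-reflexive (shifted-top {d} α ≤-refl)) ,
    composition-part≥1 β-composition 1≤d (≤-trans (m≤m+n d (length α)) (≤-reflexive (Fits.rows fits)))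

  no-box⇒≡ : ∀ {d α} → Fits d α β → (∀ {r c} → ¬ Box d α r c) → α ≡ β
  no-box⇒≡ {suc d} fits empty = ⊥-elim (empty (top-box fits (s≤s z≤n)))
  no-box⇒≡ {zero} {α} fits empty =
    ≡-by-parts α β rows λ i 1≤i → ≤-antisym (inside 1≤i) (≮⇒≥ λ α<β → empty (≤-refl , α<β))
    where open Fits fits

  dominoes-beyond : ∀ {d α r₀ s} (peel : Peel d α r₀ s) → NcBorder d α →
    Box d α r₀ s → Box d α r₀ (suc s) → (∀ {j} → j < s → ¬ Domino d α j) →
    ∀ {c} → Domino (Peel.d′ peel) (Peel.α′ peel) c → s < c
  dominoes-beyond {s = s} peel nc box box⁺ minimal {c} (r , b , b⁺) with <-cmp s c
  ... | tri< s<c _ _  = s<c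
  ... | tri≈ _ refl _ = ⊥-elim (removed (subst (λ r → Box d′ α′ r s) r≡r₀ b))
    where
      open Peel peel
      r≡r₀ : r ≡ _
      r≡r₀ = domino-row-unique nc (shrinks b) (shrinks b⁺) box box⁺
  ... | tri> _ _ c<s  = ⊥-elim (minimal c<s (r , shrinks b , shrinks b⁺))
    where open Peel peel

  module Choice {d α} (α-comp : IsComposition α) (fits : Fits d α β) (nc : NcBorder d α) where
    open Fits fits
    open NcBorder nc

    row∈range : ∀ {r c} → Box d α r c → 1 ≤ r × r ≤ length β
    row∈range (lo<c , c≤β) = part≥1⇒index∈range β (≤-trans (s≤s z≤n) (≤-trans lo<c c≤β))

    floor≡0⇒top : ∀ {r c} → Box d α r c → shifted d α r ≡ 0 → 1 ≤ d × r ≤ d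
    floor≡0⇒top {r} b floor≡0 = ≤-trans (proj₁ (row∈range b)) r≤d , r≤d
      where
        r≤d : r ≤ d
        r≤d = ≮⇒≥ λ d<r → <-irrefl (sym floor≡0) (composition-part≥1 α-comp (m<n⇒0<n∸m d<r)
                (≤-trans (∸-monoˡ-≤ d (proj₂ (row∈range b))) (≤-reflexive (fits-length fits))))

    row-start : ∀ {r s} → Box d α r s → (∀ {j} → j < s → ¬ Domino d α j) → suc (shifted d α r) ≡ s
    row-start {r} {suc s} box@(lo<s , s≤β) no-earlier with m≤n⇒m<n∨m≡n lo<s
    ... | inj₂ eq  = eq
    ... | inj₁ lt  = ⊥-elim (no-earlier ≤-refl (r , (≤-pred lt , ≤-trans (n≤1+n s) s≤β) , box))

    box? : ∀ r c → Dec (Box d α r c)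
    box? r c = shifted d α r <? c ×-dec c ≤? part β r

    row-bound : ∀ {r c} → Box d α r c → r < suc (length β)
    row-bound b = s≤s (proj₂ (row∈range b))

    column-bound : ∀ {r c} → Box d α r c → c < suc (sum β)
    column-bound {r} (_ , c≤β) = s≤s (≤-trans c≤β (part≤sum β r))

    column? : ∀ c → Dec (Column d α c)
    column? c = BoundedSearch.∃? (λ r → box? r c) (suc (length β)) row-bound

    columns? : Dec (∃ (Column d α))
    columns? = BoundedSearch.∃? column? (suc (sum β)) (λ (_ , b) → column-bound b)

    domino? : ∀ c → Dec (Domino d α c)
    domino? c = BoundedSearch.∃? (λ r → box? r c ×-dec box? r (suc c)) (suc (length β)) (λ (b , _) → row-bound b)

    inherits : ∀ {r r₀ c} → d < r → r < r₀ → shifted d α r ≡ shifted d α r₀ →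
               Box d α r₀ c → Box d α r c
    inherits d<r r<r₀ same (lo<c , c≤β) =
      subst (_< _) (sym same) lo<c , ≤-trans c≤β (ordered d<r r<r₀ (≤-reflexive (sym same)))

    under-top : ∀ {r v} → shifted d α r ≡ suc v → d < r
    under-top floor≡ = ≰⇒> λ r≤d → 0≢1+n (trans (sym (shifted-top α r≤d)) floor≡)

    domino-move : ∀ {r₀ s} → Box d α r₀ s → Box d α r₀ (suc s) → (∀ {j} → j < s → ¬ Domino d α j) →
                  Move d α
    domino-move {r₀} {suc zero} box box⁺ minimal =
      Extend.extend-domino peel (top-box fits 1≤d) box⁺′ (dominoes-beyond peel nc (top-box fits 1≤d) box⁺′ minimal)
      where
        floor≡ : shifted d α r₀ ≡ 0
        floor≡ = suc-injective (row-start box minimal)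
        1≤d : 1 ≤ d
        1≤d = proj₁ (floor≡0⇒top box floor≡)
        r₀≡d : r₀ ≡ d
        r₀≡d = ≤-antisym (proj₂ (floor≡0⇒top box floor≡)) (bottom box box⁺ (top-box fits 1≤d))
        box⁺′ : Box d α d 2
        box⁺′ = subst (λ r → Box d α r 2) r₀≡d box⁺
        later : ∀ {r} → d < r → shifted d α r ≤ 1 → part β r ≤ part β d
        later d<r lo≤1 = ≮⇒≥ λ β<β → <⇒≱ d<r (top ≤-refl
          (s≤s lo≤1 , ≤-trans (proj₂ box⁺′) (<⇒≤ β<β))
          (≤-trans (s≤s lo≤1) (n≤1+n 2) , ≤-trans (s≤s (proj₂ box⁺′)) β<β)
          box⁺′)
        peel : Peel d α d 1
        peel = peel-prepend 1≤d α-comp fits (proj₂ (top-box fits 1≤d)) later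
    domino-move {r₀} {suc (suc v)} box box⁺ minimal =
      Extend.extend-domino peel box box⁺ (dominoes-beyond peel nc box box⁺ minimal)
      where
        floor≡ : shifted d α r₀ ≡ suc v
        floor≡ = suc-injective (row-start box minimal)
        earlier : ∀ {r} → d < r → r < r₀ → shifted d α r ≢ suc v
        earlier d<r r<r₀ eq =
          <⇒≱ r<r₀ (top (s≤s (s≤s z≤n)) box box⁺ (inherits d<r r<r₀ (trans eq (sym floor≡)) box))
        later : ∀ {r} → r₀ < r → shifted d α r ≡ suc (suc v) → part β r ≤ part β r₀
        later r₀<r eq = ≮⇒≥ λ β<β → <⇒≱ r₀<r (top (s≤s (s≤s z≤n))
          (s≤s (≤-reflexive eq) , ≤-trans (proj₂ box⁺) (<⇒≤ β<β))
          (≤-trans (s≤s (≤-reflexive eq)) (n≤1+n _) , ≤-trans (s≤s (proj₂ box⁺)) β<β)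
          box⁺)
        peel : Peel d α r₀ (suc (suc v))
        peel = peel-incLeftmost α-comp fits (under-top floor≡) floor≡ (proj₂ box) earlier later

    vertical-move : ∀ {rb b} → Box d α rb b → (∀ {r c} → Box d α r c → c ≤ b) →
                    (∀ {c} → ¬ Domino d α c) → Move d α
    vertical-move {b = zero} (() , _) _ _
    vertical-move {b = suc zero} box highest flat = Extend.extend-vertical peel (top-box fits 1≤d) flat highest
      where
        1≤d : 1 ≤ d
        1≤d = proj₁ (floor≡0⇒top box (suc-injective (row-start box λ _ → flat)))
        later : ∀ {r} → d < r → shifted d α r ≤ 1 → part β r ≤ part β d
        later d<r lo≤1 = ≮⇒≥ λ β<β →
          <-irrefl refl (highest (s≤s lo≤1 , ≤-trans (s≤s (proj₂ (top-box fits 1≤d))) β<β))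
        peel : Peel d α d 1
        peel = peel-prepend 1≤d α-comp fits (proj₂ (top-box fits 1≤d)) later
    vertical-move {rb} {suc (suc b)} box highest flat with BoundedSearch.least (λ r → box? r (suc (suc b))) rb box
    ... | r₀ , box₀ , topmost = Extend.extend-vertical peel box₀ flat highest
      where
        floor≡ : shifted d α r₀ ≡ suc b
        floor≡ = suc-injective (row-start box₀ λ _ → flat)
        earlier : ∀ {r} → d < r → r < r₀ → shifted d α r ≢ suc b
        earlier d<r r<r₀ eq = topmost r<r₀ (inherits d<r r<r₀ (trans eq (sym floor≡)) box₀)
        later : ∀ {r} → r₀ < r → shifted d α r ≡ suc (suc b) → part β r ≤ part β r₀
        later r₀<r eq = ≮⇒≥ λ β<β →
          <-irrefl refl (highest (s≤s (≤-reflexive eq) , ≤-trans (s≤s (proj₂ box₀)) β<β))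
        peel : Peel d α r₀ (suc (suc b))
        peel = peel-incLeftmost α-comp fits (under-top floor≡) floor≡ (proj₂ box₀) earlier later

    next-move : ∃ (Column d α) → Move d α
    next-move (c₀ , col₀) with BoundedSearch.∃? domino? (suc (sum β)) (λ (_ , b , _) → column-bound b)
    ... | yes (c , dom) with BoundedSearch.least domino? c dom
    ...   | _ , (_ , box , box⁺) , minimal = domino-move box box⁺ minimal
    next-move (c₀ , col₀) | no flat
      with BoundedSearch.greatest column? (suc (sum β)) (λ (_ , b) → column-bound b) c₀ col₀
    ... | _ , (_ , box) , highest = vertical-move box (λ b → highest (_ , b)) (λ dom → flat (_ , dom))

  build : ∀ k {d α} → IsComposition α → Fits d α β → NcBorder d α → sum α + k ≡ sum β → Spelling d α k
  build k {d} {α} α-comp fits nc total with Choice.columns? α-comp fits nc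
  ... | no empty = record
    { word          = []
    ; hook          = inj₁ refl
    ; spells        = cong just α≡β
    ; length≡       = sym k≡0
    ; letter⇒column = λ ()
    ; column⇒letter = λ b → ⊥-elim (empty (_ , _ , b))
    ; ending        = inj₁ []
    }
    where
      α≡β : α ≡ β
      α≡β = no-box⇒≡ fits (λ b → empty (_ , _ , b))
      k≡0 : k ≡ 0
      k≡0 = +-cancelˡ-≡ (sum α) k 0 (begin
        sum α + k ≡⟨ total ⟩
        sum β     ≡⟨ cong sum (sym α≡β) ⟩
        sum α     ≡⟨ +-identityʳ (sum α) ⟨
        sum α + 0 ∎)
        where open ≡-Reasoning
  ... | yes col = continue k total (Choice.next-move α-comp fits nc col)
    where
      continue : ∀ k → sum α + k ≡ sum β → Move d α → Spelling d α k
      continue zero total move = ⊥-elim (<-irrefl refl (begin-strict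
        sum α         <⟨ ≤-reflexive (sym grows) ⟩
        sum α′        ≤⟨ fits⇒sum≤ fits′ ⟩
        sum β         ≡⟨ sym total ⟩
        sum α + 0     ≡⟨ +-identityʳ (sum α) ⟩
        sum α         ∎))
        where
          open Peel (Move.peel move) renaming (fits to fits′)
          open ≤-Reasoning
      continue (suc k) total move =
        Move.extend move (build k composition fits′ (ncBorder-shrink shrinks nc)
          (trans (cong (_+ k) grows) (trans (sym (+-suc (sum α) k)) total)))
        where open Peel (Move.peel move) renaming (fits to fits′)

  box⇒inSkew : ∀ {d α r c} → Fits d α β → Box d α r c → InSkew α β r c
  box⇒inSkew {d} {α} {r} {c} fits (lo<c , c≤β) = (≤-trans (s≤s z≤n) lo<c , c≤β) , outside
    where
      outside : ¬ (Σ ℕ λ i → r ≡ i + (length β ∸ length α) × InDiagram α i c)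
      outside (i , r≡ , _ , c≤α) = <⇒≱ lo<c (subst (λ j → c ≤ part α j) (sym r∸d≡i) c≤α)
        where
          r∸d≡i : r ∸ d ≡ i
          r∸d≡i = trans (cong (_∸ d) (trans r≡ (cong (i +_) (fits-extraRows fits)))) (m+n∸n≡m i d)

  inSkew⇒box : ∀ {d α r c} → Fits d α β → InSkew α β r c → Box d α r c
  inSkew⇒box {d} {α} {r} {c} fits ((1≤c , c≤β) , outside) = ≰⇒> c≰lo , c≤β
    where
      c≰lo : c ≰ shifted d α r
      c≰lo c≤lo = outside (r ∸ d , r≡ , 1≤c , c≤lo)
        where
          d<r : d < r
          d<r = m∸n≢0⇒n<m λ r∸d≡0 →
            <⇒≱ (≤-trans 1≤c c≤lo) (≤-reflexive (trans (cong (part α) r∸d≡0) (part-zero α)))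
          r≡ : r ≡ r ∸ d + (length β ∸ length α)
          r≡ = trans (sym (m∸n+n≡m (<⇒≤ d<r))) (cong (r ∸ d +_) (sym (fits-extraRows fits)))

  ncBorder : ∀ {d α} → Fits d α β → IsNcBorderStrip α β → NcBorder d α
  ncBorder fits (_ , nc₁ , nc₂) = record
    { bottom = λ a b a′ → nc₁ _ (box⇒inSkew fits a) (box⇒inSkew fits b) _ (box⇒inSkew fits a′)
    ; top    = λ 2≤j a b a′ → nc₂ _ _ 2≤j (box⇒inSkew fits a) (box⇒inSkew fits b) _ (box⇒inSkew fits a′)
    }

  spelling⇒CRHW : ∀ {d α n} → Fits d α β → IsIntervalShape α β → 1 ≤ n →
                  (sp : Spelling d α n) → CRHW n (Spelling.word sp)
  spelling⇒CRHW {α = α} fits interval 1≤n sp = length≡ , letters≥1 , hookword hook , connected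
    where
      open Spelling sp
      letters≥1 : All (1 ≤_) word
      letters≥1 = tabulate λ c∈ → ≤-trans (s≤s z≤n) (proj₁ (proj₂ (letter⇒column c∈)))
      hookword : word ≡ [] ⊎ IsReverseHookword word → IsReverseHookword word
      hookword (inj₁ w≡[]) = ⊥-elim (<⇒≱ 1≤n (≤-reflexive (trans (sym length≡) (cong length w≡[]))))
      hookword (inj₂ hook) = hook
      support : ∀ {c} → c ∈ word → InSupport α β c
      support c∈ = let (r , b) = letter⇒column c∈ in r , box⇒inSkew fits b
      connected : IsConnected word
      connected a b c a∈ b∈ a≤c c≤b =
        column⇒letter (inSkew⇒box fits (proj₂ (interval a b c (support a∈) (support b∈) a≤c c≤b)))

lemma5p3 : (α β : List ℕ) (n : ℕ) → IsComposition α → IsComposition β → 1 ≤ n →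
    α <c β → IsNcBorderStrip α β → skewSize α β ≡ n →
    Σ (List ℕ) λ w → CRHW n w × act w α ≡ just β
lemma5p3 α β n α-comp β-comp 1≤n α<β strip size = word , spelling⇒CRHW fits (proj₁ strip) 1≤n sp , spells
  where
    open Peeling β β-comp
    fits : Fits (length β ∸ length α) α β
    fits = <c⇒fits α<β
    total : sum α + n ≡ sum β
    total = trans (cong (sum α +_) (sym size)) (m+[n∸m]≡n (<⇒≤ (sum-<c α<β)))
    sp : Spelling (length β ∸ length α) α n
    sp = build n α-comp fits (ncBorder fits strip) total
    open Spelling sp
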